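{- Let $w\in S_n$ avoid the patterns $3412$ and $4231$, and let $r_1=1<r_2<\cdots<r_s$ be the record positions of $w$. Then the ordering of $\{1,\dots,n\}$ given by $$[r_s,n],\ [r_{s-1},r_s-1],\ \dots,\ [r_2,r_3-1],\ [r_1,r_2-1]$$ (each interval $[a,b]=\{a,a+1,\dots,b\}$ listed in increasing order) is a perfect elimination ordering of the inversion graph $G_w$.
   Context: An index $r$ is a record position of $w$ if $w(r)>\max(w(1),\dots,w(r-1))$. The inversion graph $G_w$ has vertices $\{1,\dots,n\}$ and edges $\{i,j\}$ for $i<j$ with $w(i)>w(j)$. A perfect elimination ordering of a graph is an ordering $v_1,\dots,v_n$ of its vertices such that for each $i$, the neighbors of $v_i$ among $v_1,\dots,v_{i-1}$ form a clique. Pattern avoidance: $w$ avoids $\sigma\in S_k$ if no length-$k$ subsequence of $w(1)\cdots w(n)$ has the same relative order as $\sigma$. -}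

module Defs where

open import Data.Nat using (ℕ; suc)
open import Data.Fin using (Fin; toℕ; _<_; _≟_)
open import Data.Fin.Properties using (all?; _<?_)
open import Data.Fin.Permutation using (Permutation′; _⟨$⟩ʳ_)
open import Data.List using (List; []; _∷_; filter; concat; reverse; allFin; length; lookup)
open import Data.List.Relation.Unary.Unique.Propositional using (Unique)
open import Data.List.Membership.Propositional using (_∈_)
open import Data.Product using (_×_; Σ; ∃; _,_)
open import Data.Sum using (_⊎_)
open import Relation.Nullary using (Dec; ¬_)
open import Relation.Nullary.Decidable using (_→-dec_; _×-dec_)
import Data.Nat as ℕ
import Data.Nat.Properties as ℕP
open import Relation.Binary.PropositionalEquality using (_≡_)

-- Positions and values are 0-indexed: a permutation w ∈ S_n is an element of
-- Permutation′ n (a bijection Fin n ↔ Fin n); w(i) is  w ⟨$⟩ʳ i.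

Contains : ∀ {n k} → Permutation′ n → (Fin k → Fin k) → Set
Contains {n} {k} w σ =
  Σ (Fin k → Fin n) λ p →
    (∀ a b → a < b → p a < p b) ×
    (∀ a b → (w ⟨$⟩ʳ p a < w ⟨$⟩ʳ p b → σ a < σ b) ×
             (σ a < σ b → w ⟨$⟩ʳ p a < w ⟨$⟩ʳ p b))

Avoids : ∀ {n k} → Permutation′ n → (Fin k → Fin k) → Set
Avoids w σ = ¬ Contains w σ

-- one-line notations 3412 and 4231 (0-indexed values: 2301 and 3120)
p3412 : Fin 4 → Fin 4
p3412 Fin.zero = Fin.suc (Fin.suc Fin.zero)
p3412 (Fin.suc Fin.zero) = Fin.suc (Fin.suc (Fin.suc Fin.zero))
p3412 (Fin.suc (Fin.suc Fin.zero)) = Fin.zero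
p3412 (Fin.suc (Fin.suc (Fin.suc Fin.zero))) = Fin.suc Fin.zero

p4231 : Fin 4 → Fin 4
p4231 Fin.zero = Fin.suc (Fin.suc (Fin.suc Fin.zero))
p4231 (Fin.suc Fin.zero) = Fin.suc Fin.zero
p4231 (Fin.suc (Fin.suc Fin.zero)) = Fin.suc (Fin.suc Fin.zero)
p4231 (Fin.suc (Fin.suc (Fin.suc Fin.zero))) = Fin.zero

IsRecord : ∀ {n} → Permutation′ n → Fin n → Set
IsRecord w r = ∀ j → j < r → w ⟨$⟩ʳ j < w ⟨$⟩ʳ r

isRecord? : ∀ {n} (w : Permutation′ n) (r : Fin n) → Dec (IsRecord w r)
isRecord? w r = all? (λ j → (j <? r) →-dec (w ⟨$⟩ʳ j <? w ⟨$⟩ʳ r))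

records : ∀ {n} → Permutation′ n → List (Fin n)
records {n} w = filter (isRecord? w) (allFin n)

interval : ∀ {n} → Fin n → ℕ → List (Fin n)
interval {n} a b =
  filter (λ i → (toℕ a ℕ.≤? toℕ i) ×-dec (toℕ i ℕ.<? b)) (allFin n)

blocks : ∀ {n} → List (Fin n) → List (List (Fin n))
blocks [] = []
blocks {n} (r ∷ []) = interval r n ∷ []
blocks (r ∷ r′ ∷ rs) = interval r (toℕ r′) ∷ blocks (r′ ∷ rs)

recordOrdering : ∀ {n} → Permutation′ n → List (Fin n)
recordOrdering w = concat (reverse (blocks (records w)))

InvEdge : ∀ {n} → Permutation′ n → Fin n → Fin n → Set
InvEdge w i j = (i < j × w ⟨$⟩ʳ j < w ⟨$⟩ʳ i) ⊎ (j < i × w ⟨$⟩ʳ i < w ⟨$⟩ʳ j)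

IsPEO : ∀ {n} → (Fin n → Fin n → Set) → List (Fin n) → Set
IsPEO {n} E vs =
  Unique vs × (∀ v → v ∈ vs) ×
  (∀ (a b c : Fin (length vs)) → b < a → c < a → ¬ (b ≡ c) →
     E (lookup vs a) (lookup vs b) → E (lookup vs a) (lookup vs c) →
     E (lookup vs b) (lookup vs c))

module Submission where

-- The ordering is the list sorted for the relation  Precedes u v :
-- either u < v in the same block (no record in (u, v]), or v < u and u lies
-- in a later block (some record in (v, u]).  If y precedes x and is adjacent
-- to x, then either y < x, w(y) > w(x) and y is in the block of x (a "left"
-- neighbour), or x < y, w(y) < w(x) and y is in a later block (a "right"
-- neighbour).  Two left neighbours y < z of x are adjacent, or the record
-- dominating z would form a 4231 with y, z, x; two right neighbours
-- y < z are adjacent, or the record separating x from y would form a 3412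
-- with x, y, z; a left and a right neighbour are adjacent by transitivity.

open import Defs
open import Function using (_∘_; id)
open import Data.Nat using (ℕ; suc; z≤n; s≤s)
import Data.Nat as ℕ
import Data.Nat.Properties as ℕP
open import Data.Fin using (Fin; toℕ; inject₁; _<_; _≤_) renaming (zero to fz; suc to fs)
import Data.Fin.Properties as FP
open import Data.Fin.Induction using (<-wellFounded)
open import Data.Fin.Permutation using (Permutation′; _⟨$⟩ʳ_; _⟨$⟩ˡ_; inverseˡ)
open import Data.List using (List; []; _∷_; concat; reverse; allFin; lookup; _++_; _∷ʳ_)
open import Data.List.Properties using (unfold-reverse; concat-++; ++-identityʳ)
open import Data.List.Relation.Unary.All using (All; []; _∷_)
import Data.List.Relation.Unary.All as All
import Data.List.Relation.Unary.All.Properties as AllP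
open import Data.List.Relation.Unary.AllPairs using (AllPairs; []; _∷_)
import Data.List.Relation.Unary.AllPairs as AllPairs
import Data.List.Relation.Unary.AllPairs.Properties as AllPairsP
open import Data.List.Relation.Unary.Unique.Propositional using (Unique)
open import Data.List.Relation.Unary.Any using (here; there)
open import Data.List.Membership.Propositional using (_∈_)
open import Data.List.Membership.Propositional.Properties
  using (∈-filter⁺; ∈-filter⁻; ∈-allFin; ∈-lookup; ∈-++⁻; ∈-++⁺ˡ; ∈-++⁺ʳ)
open import Data.Product using (_×_; ∃; _,_; proj₁; proj₂)
open import Data.Sum using (_⊎_; inj₁; inj₂)
open import Induction.WellFounded using (Acc; acc)
open import Relation.Nullary using (Dec; yes; no; ¬_; contradiction)
open import Relation.Nullary.Decidable using (_→-dec_; _×-dec_)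
open import Relation.Binary using (tri<; tri≈; tri>)
open import Relation.Binary.PropositionalEquality
  using (_≡_; _≢_; refl; sym; trans; cong; subst; subst₂; module ≡-Reasoning)

StepIncreasing : ∀ {k} → (Fin (suc k) → ℕ) → Set
StepIncreasing {k} f = ∀ (i : Fin k) → f (inject₁ i) ℕ.< f (fs i)

step⇒strict : ∀ {k} (f : Fin (suc k) → ℕ) → StepIncreasing f →
  ∀ {a b} → a < b → f a ℕ.< f b
step⇒strict f step {fz} {fz} ()
step⇒strict f step {fz} {fs fz} _ = step fz
step⇒strict {suc k} f step {fz} {fs (fs b)} _ =
  ℕP.<-trans (step fz) (step⇒strict (f ∘ fs) (step ∘ fs) {fz} {fs b} (s≤s z≤n))
step⇒strict {suc k} f step {fs a} {fs b} (s≤s a<b) =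
  step⇒strict (f ∘ fs) (step ∘ fs) a<b

quadruple : {A : Set} → A → A → A → A → Fin 4 → A
quadruple a b c d fz = a
quadruple a b c d (fs fz) = b
quadruple a b c d (fs (fs fz)) = c
quadruple a b c d (fs (fs (fs fz))) = d

increasing₄ : (f : Fin 4 → ℕ) → f fz ℕ.< f (fs fz) → f (fs fz) ℕ.< f (fs (fs fz)) →
  f (fs (fs fz)) ℕ.< f (fs (fs (fs fz))) → StepIncreasing f
increasing₄ f step₀ step₁ step₂ fz = step₀
increasing₄ f step₀ step₁ step₂ (fs fz) = step₁
increasing₄ f step₀ step₁ step₂ (fs (fs fz)) = step₂

-- Both forbidden patterns are involutions, which is what lets us read off
-- an occurrence from the order of its values (see occurrence below).
p3412-involutive : ∀ a → p3412 (p3412 a) ≡ a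
p3412-involutive fz = refl
p3412-involutive (fs fz) = refl
p3412-involutive (fs (fs fz)) = refl
p3412-involutive (fs (fs (fs fz))) = refl

p4231-involutive : ∀ a → p4231 (p4231 a) ≡ a
p4231-involutive fz = refl
p4231-involutive (fs fz) = refl
p4231-involutive (fs (fs fz)) = refl
p4231-involutive (fs (fs (fs fz))) = refl

allPairs-refine : {A : Set} {Q : A → Set} {R S : A → A → Set} {xs : List A} →
  All Q xs → AllPairs R xs → (∀ {x y} → Q x → Q y → R x y → S x y) → AllPairs S xs
allPairs-refine [] [] refine = []
allPairs-refine {Q = Q} {R} {S} (qx ∷ qxs) (rx ∷ rxs) refine =
  row qxs rx ∷ allPairs-refine qxs rxs refine
  where
  row : ∀ {ys} → All Q ys → All (R _) ys → All (S _) ys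
  row [] [] = []
  row (qy ∷ qys) (r ∷ rs) = refine qx qy r ∷ row qys rs

lookupPairs : {A : Set} {R : A → A → Set} {xs : List A} → AllPairs R xs →
  ∀ {i j} → i < j → R (lookup xs i) (lookup xs j)
lookupPairs (r ∷ rs) {fz} {fs j} _ = All.lookup r (∈-lookup j)
lookupPairs (r ∷ rs) {fs i} {fs j} (s≤s i<j) = lookupPairs rs i<j

lookup-distinct : {A : Set} {xs : List A} → Unique xs →
  ∀ {i j} → i ≢ j → lookup xs i ≢ lookup xs j
lookup-distinct unique {i} {j} i≢j with FP.<-cmp i j
... | tri< i<j _ _ = lookupPairs unique i<j
... | tri≈ _ i≡j _ = contradiction i≡j i≢j
... | tri> _ _ j<i = lookupPairs unique j<i ∘ sym

perfectElimination : ∀ {n} {E _≺_ : Fin n → Fin n → Set} {vs : List (Fin n)} →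
  (∀ {x y} → x ≺ y → x ≢ y) → AllPairs _≺_ vs → (∀ v → v ∈ vs) →
  (∀ {x y z} → y ≺ x → z ≺ x → y ≢ z → E x y → E x z → E y z) →
  IsPEO E vs
perfectElimination {vs = vs} irreflexive sorted complete clique =
  unique , complete ,
  λ a b c b<a c<a b≢c →
    clique (lookupPairs sorted b<a) (lookupPairs sorted c<a) (lookup-distinct unique b≢c)
  where
  unique : Unique vs
  unique = AllPairs.map irreflexive sorted

module _ {n : ℕ} (w : Permutation′ n) where

  value : Fin n → ℕ
  value i = toℕ (w ⟨$⟩ʳ i)

  value-injective : ∀ {i j} → value i ≡ value j → i ≡ j
  value-injective {i} {j} eq = begin
    i                  ≡⟨ sym (inverseˡ w) ⟩
    w ⟨$⟩ˡ (w ⟨$⟩ʳ i)  ≡⟨ cong (w ⟨$⟩ˡ_) (FP.toℕ-injective eq) ⟩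
    w ⟨$⟩ˡ (w ⟨$⟩ʳ j)  ≡⟨ inverseˡ w ⟩
    j                  ∎
    where open ≡-Reasoning

  occurrence : ∀ {k} (σ : Fin (suc k) → Fin (suc k)) → (∀ a → σ (σ a) ≡ a) →
    (p : Fin (suc k) → Fin n) →
    StepIncreasing (toℕ ∘ p) → StepIncreasing (value ∘ p ∘ σ) → Contains w σ
  occurrence σ σ-involutive p positions values =
    p , (λ a b → step⇒strict (toℕ ∘ p) positions) , (λ a b → reflects a b , preserves a b)
    where
    preserves : ∀ a b → σ a < σ b → value (p a) ℕ.< value (p b)
    preserves a b σa<σb =
      subst₂ (λ a′ b′ → value (p a′) ℕ.< value (p b′)) (σ-involutive a) (σ-involutive b)
        (step⇒strict (value ∘ p ∘ σ) values σa<σb)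
    reflects : ∀ a b → value (p a) ℕ.< value (p b) → σ a < σ b
    reflects a b pa<pb with FP.<-cmp (σ a) (σ b)
    ... | tri< σa<σb _ _ = σa<σb
    ... | tri≈ _ σa≡σb _ = contradiction (cong (value ∘ p) a≡b) (ℕP.<⇒≢ pa<pb)
      where
      a≡b : a ≡ b
      a≡b = trans (sym (σ-involutive a)) (trans (cong σ σa≡σb) (σ-involutive b))
    ... | tri> _ _ σb<σa = contradiction (preserves b a σb<σa) (ℕP.<-asym pa<pb)

  contains3412 : ∀ {x₀ x₁ x₂ x₃} → x₀ < x₁ → x₁ < x₂ → x₂ < x₃ →
    value x₂ ℕ.< value x₃ → value x₃ ℕ.< value x₀ → value x₀ ℕ.< value x₁ →
    Contains w p3412
  contains3412 {x₀} {x₁} {x₂} {x₃} p₀ p₁ p₂ v₀ v₁ v₂ =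
    occurrence p3412 p3412-involutive points
      (increasing₄ (toℕ ∘ points) p₀ p₁ p₂) (increasing₄ (value ∘ points ∘ p3412) v₀ v₁ v₂)
    where
    points : Fin 4 → Fin n
    points = quadruple x₀ x₁ x₂ x₃

  contains4231 : ∀ {x₀ x₁ x₂ x₃} → x₀ < x₁ → x₁ < x₂ → x₂ < x₃ →
    value x₃ ℕ.< value x₁ → value x₁ ℕ.< value x₂ → value x₂ ℕ.< value x₀ →
    Contains w p4231
  contains4231 {x₀} {x₁} {x₂} {x₃} p₀ p₁ p₂ v₀ v₁ v₂ =
    occurrence p4231 p4231-involutive points
      (increasing₄ (toℕ ∘ points) p₀ p₁ p₂) (increasing₄ (value ∘ points ∘ p4231) v₀ v₁ v₂)
    where
    points : Fin 4 → Fin n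
    points = quadruple x₀ x₁ x₂ x₃

  nonRecord-witness : ∀ {j} → ¬ IsRecord w j → ∃ λ k → k < j × value j ℕ.≤ value k
  nonRecord-witness {j} ¬isRec
    with FP.¬∀⟶∃¬ n (λ k → k < j → w ⟨$⟩ʳ k < w ⟨$⟩ʳ j)
           (λ k → (k FP.<? j) →-dec (w ⟨$⟩ʳ k FP.<? w ⟨$⟩ʳ j)) ¬isRec
  ... | k , ¬larger with k FP.<? j
  ...   | yes k<j = k , k<j , ℕP.≮⇒≥ (λ vk<vj → ¬larger (λ _ → vk<vj))
  ...   | no k≮j = contradiction (λ k<j → contradiction k<j k≮j) ¬larger

  -- Every position j is dominated by a record m ≤ j with w(j) ≤ w(m):
  -- walk left to larger values until a record is reached.
  dominatingRecord : ∀ j → ∃ λ m → IsRecord w m × m ≤ j × value j ℕ.≤ value m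
  dominatingRecord j = walk j (<-wellFounded j)
    where
    walk : ∀ j → Acc _<_ j → ∃ λ m → IsRecord w m × m ≤ j × value j ℕ.≤ value m
    walk j (acc smaller) with isRecord? w j
    ... | yes isRec = j , isRec , ℕP.≤-refl , ℕP.≤-refl
    ... | no ¬isRec with nonRecord-witness ¬isRec
    ...   | k , k<j , vj≤vk with walk k (smaller k<j)
    ...     | m , isRec , m≤k , vk≤vm =
      m , isRec , ℕP.≤-trans m≤k (ℕP.<⇒≤ k<j) , ℕP.≤-trans vj≤vk vk≤vm

  -- some record t with a < t ≤ b, i.e. a and b lie in different blocks
  RecordIn : Fin n → Fin n → Set
  RecordIn a b = ∃ λ t → IsRecord w t × a < t × t ≤ b

  -- u comes before v in the record ordering: u < v in the same block, or
  -- v < u with u in a later block.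
  Precedes : Fin n → Fin n → Set
  Precedes u v = (u < v × ¬ RecordIn u v) ⊎ (v < u × RecordIn v u)

  precedes⇒≢ : ∀ {u v} → Precedes u v → u ≢ v
  precedes⇒≢ (inj₁ (u<v , _)) = FP.<⇒≢ u<v
  precedes⇒≢ (inj₂ (v<u , _)) = FP.<⇒≢ v<u ∘ sym

  data EarlierNeighbour (x y : Fin n) : Set where
    left  : y < x → value x ℕ.< value y → ¬ RecordIn y x → EarlierNeighbour x y
    right : x < y → value y ℕ.< value x → RecordIn x y → EarlierNeighbour x y

  earlierNeighbour : ∀ {x y} → Precedes y x → InvEdge w x y → EarlierNeighbour x y
  earlierNeighbour (inj₁ (y<x , same)) (inj₁ (x<y , _)) = contradiction x<y (FP.<-asym y<x)
  earlierNeighbour (inj₁ (y<x , same)) (inj₂ (_ , vx<vy)) = left y<x vx<vy same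
  earlierNeighbour (inj₂ (x<y , later)) (inj₁ (_ , vy<vx)) = right x<y vy<vx later
  earlierNeighbour (inj₂ (x<y , later)) (inj₂ (y<x , _)) = contradiction y<x (FP.<-asym x<y)

  -- Two left neighbours y < z of x are adjacent: otherwise the record m
  -- dominating z lies before y (it cannot lie in the block of x), and
  -- m, y, z, x form a 4231.
  leftNeighbours-adjacent : Avoids w p4231 → ∀ {x y z} → y < z → z < x →
    value x ℕ.< value y → value x ℕ.< value z → ¬ RecordIn y x → value z ℕ.< value y
  leftNeighbours-adjacent avoids {x} {y} {z} y<z z<x vx<vy vx<vz sameBlock
    with ℕP.<-cmp (value z) (value y)
  ... | tri< vz<vy _ _ = vz<vy
  ... | tri≈ _ vz≡vy _ = contradiction (value-injective vz≡vy) (FP.<⇒≢ y<z ∘ sym)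
  ... | tri> _ _ vy<vz with dominatingRecord z
  ...   | m , isRec , m≤z , vz≤vm with FP.<-cmp m y
  ...     | tri< m<y _ _ = contradiction (contains4231 m<y y<z z<x vx<vy vy<vz vz<vm) avoids
    where
    vz<vm : value z ℕ.< value m
    vz<vm = ℕP.≤∧≢⇒< vz≤vm (FP.<⇒≢ (FP.<-trans m<y y<z) ∘ sym ∘ value-injective)
  ...     | tri≈ _ m≡y _ =
    contradiction (subst (λ t → value z ℕ.≤ value t) m≡y vz≤vm) (ℕP.<⇒≱ vy<vz)
  ...     | tri> _ _ y<m =
    contradiction (m , isRec , y<m , ℕP.≤-trans m≤z (ℕP.<⇒≤ z<x)) sameBlock

  -- Two right neighbours y < z of x are adjacent: otherwise the record t
  -- separating x from y satisfies t < y, and x, t, y, z form a 3412.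
  rightNeighbours-adjacent : Avoids w p3412 → ∀ {x y z} → x < y → y < z →
    value y ℕ.< value x → value z ℕ.< value x → RecordIn x y → value z ℕ.< value y
  rightNeighbours-adjacent avoids {x} {y} {z} x<y y<z vy<vx vz<vx (t , isRec , x<t , t≤y)
    with ℕP.<-cmp (value z) (value y)
  ... | tri< vz<vy _ _ = vz<vy
  ... | tri≈ _ vz≡vy _ = contradiction (value-injective vz≡vy) (FP.<⇒≢ y<z ∘ sym)
  ... | tri> _ _ vy<vz with ℕP.m≤n⇒m<n∨m≡n t≤y
  ...   | inj₁ t<y = contradiction (contains3412 x<t t<y y<z vy<vz vz<vx (isRec x x<t)) avoids
  ...   | inj₂ t≡y =
    contradiction (subst (λ s → value x ℕ.< value s) (FP.toℕ-injective t≡y) (isRec x x<t))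
      (ℕP.<-asym vy<vx)

  distinct⇒ordered : ∀ {y z : Fin n} → y ≢ z → y < z ⊎ z < y
  distinct⇒ordered {y} {z} y≢z with FP.<-cmp y z
  ... | tri< y<z _ _ = inj₁ y<z
  ... | tri≈ _ y≡z _ = contradiction y≡z y≢z
  ... | tri> _ _ z<y = inj₂ z<y

  earlierNeighbours-adjacent : Avoids w p3412 → Avoids w p4231 →
    ∀ {x y z} → Precedes y x → Precedes z x → y ≢ z →
    InvEdge w x y → InvEdge w x z → InvEdge w y z
  earlierNeighbours-adjacent avoids3412 avoids4231 y≺x z≺x y≢z x~y x~z
    with earlierNeighbour y≺x x~y | earlierNeighbour z≺x x~z | distinct⇒ordered y≢z
  ... | left y<x vx<vy sy | left z<x vx<vz _ | inj₁ y<z =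
    inj₁ (y<z , leftNeighbours-adjacent avoids4231 y<z z<x vx<vy vx<vz sy)
  ... | left y<x vx<vy _ | left z<x vx<vz sz | inj₂ z<y =
    inj₂ (z<y , leftNeighbours-adjacent avoids4231 z<y y<x vx<vz vx<vy sz)
  ... | left y<x vx<vy _ | right x<z vz<vx _ | _ =
    inj₁ (FP.<-trans y<x x<z , ℕP.<-trans vz<vx vx<vy)
  ... | right x<y vy<vx _ | left z<x vx<vz _ | _ =
    inj₂ (FP.<-trans z<x x<y , ℕP.<-trans vy<vx vx<vz)
  ... | right x<y vy<vx ry | right x<z vz<vx _ | inj₁ y<z =
    inj₁ (y<z , rightNeighbours-adjacent avoids3412 x<y y<z vy<vx vz<vx ry)
  ... | right x<y vy<vx _ | right x<z vz<vx rz | inj₂ z<y =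
    inj₂ (z<y , rightNeighbours-adjacent avoids3412 x<z z<y vz<vx vy<vx rz)

  Sorted : List (Fin n) → Set
  Sorted = AllPairs _<_

  allFin-sorted : Sorted (allFin n)
  allFin-sorted = AllPairsP.tabulate⁺-< id

  inInterval? : (a : Fin n) (b : ℕ) (i : Fin n) → Dec (toℕ a ℕ.≤ toℕ i × toℕ i ℕ.< b)
  inInterval? a b i = (toℕ a ℕ.≤? toℕ i) ×-dec (toℕ i ℕ.<? b)

  ∈-interval⁻ : ∀ {a b x} → x ∈ interval a b → a ≤ x × toℕ x ℕ.< b
  ∈-interval⁻ {a} {b} x∈ = proj₂ (∈-filter⁻ (inInterval? a b) {xs = allFin n} x∈)

  ∈-interval⁺ : ∀ {a b x} → a ≤ x → toℕ x ℕ.< b → x ∈ interval a b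
  ∈-interval⁺ {a} {b} {x} a≤x x<b = ∈-filter⁺ (inInterval? a b) (∈-allFin x) (a≤x , x<b)

  NoRecordAfter : Fin n → ℕ → Set
  NoRecordAfter r b = ∀ t → IsRecord w t → r < t → ¬ toℕ t ℕ.< b

  interval-precedes : ∀ r b → NoRecordAfter r b → AllPairs Precedes (interval r b)
  interval-precedes r b noRecord =
    allPairs-refine (AllP.all-filter (inInterval? r b) (allFin n))
      (AllPairsP.filter⁺ (inInterval? r b) allFin-sorted)
      (λ (r≤x , _) (_ , y<b) x<y →
        inj₁ (x<y , λ (t , isRec , x<t , t≤y) →
          noRecord t isRec (ℕP.≤-<-trans r≤x x<t) (ℕP.≤-<-trans t≤y y<b)))

  blockEnd : List (Fin n) → ℕ
  blockEnd [] = n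
  blockEnd (r′ ∷ _) = toℕ r′

  blocks-∷ : ∀ r rs → blocks (r ∷ rs) ≡ interval r (blockEnd rs) ∷ blocks rs
  blocks-∷ r [] = refl
  blocks-∷ r (r′ ∷ rs) = refl

  ordering : List (Fin n) → List (Fin n)
  ordering rs = concat (reverse (blocks rs))

  ordering-∷ : ∀ r rs → ordering (r ∷ rs) ≡ ordering rs ++ interval r (blockEnd rs)
  ordering-∷ r rs = begin
    concat (reverse (blocks (r ∷ rs)))  ≡⟨ cong (concat ∘ reverse) (blocks-∷ r rs) ⟩
    concat (reverse (block ∷ blocks rs)) ≡⟨ cong concat (unfold-reverse block (blocks rs)) ⟩
    concat (reverse (blocks rs) ∷ʳ block) ≡⟨ sym (concat-++ (reverse (blocks rs)) (block ∷ [])) ⟩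
    ordering rs ++ (block ++ [])        ≡⟨ cong (ordering rs ++_) (++-identityʳ block) ⟩
    ordering rs ++ block                ∎
    where
    open ≡-Reasoning
    block : List (Fin n)
    block = interval r (blockEnd rs)

  start<blockEnd : ∀ {r rs} → All (r <_) rs → toℕ r ℕ.< blockEnd rs
  start<blockEnd {r} [] = FP.toℕ<n r
  start<blockEnd (r<r′ ∷ _) = r<r′

  blockEnd-≤ : ∀ {rs t} → Sorted rs → t ∈ rs → blockEnd rs ℕ.≤ toℕ t
  blockEnd-≤ _ (here refl) = ℕP.≤-refl
  blockEnd-≤ (r<rs ∷ _) (there t∈) = ℕP.<⇒≤ (All.lookup r<rs t∈)

  ordering-bound : ∀ {rs x} → Sorted rs → x ∈ ordering rs → blockEnd rs ℕ.≤ toℕ x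
  ordering-bound {[]} _ ()
  ordering-bound {r ∷ rs} {x} (r<rs ∷ sorted) x∈
    with ∈-++⁻ (ordering rs) (subst (x ∈_) (ordering-∷ r rs) x∈)
  ... | inj₁ x∈later = ℕP.≤-trans (ℕP.<⇒≤ (start<blockEnd r<rs)) (ordering-bound sorted x∈later)
  ... | inj₂ x∈block = proj₁ (∈-interval⁻ x∈block)

  ordering-complete : ∀ {r rs x} → r ≤ x → x ∈ ordering (r ∷ rs)
  ordering-complete {r} {rs} {x} r≤x = subst (x ∈_) (sym (ordering-∷ r rs)) placed
    where
    later : ∀ rs → ¬ toℕ x ℕ.< blockEnd rs → x ∈ ordering rs
    later [] x≮n = contradiction (FP.toℕ<n x) x≮n
    later (r′ ∷ rs′) x≮r′ = ordering-complete {rs = rs′} (ℕP.≮⇒≥ x≮r′)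
    placed : x ∈ ordering rs ++ interval r (blockEnd rs)
    placed with toℕ x ℕ.<? blockEnd rs
    ... | yes x<end = ∈-++⁺ʳ (ordering rs) (∈-interval⁺ r≤x x<end)
    ... | no x≮end = ∈-++⁺ˡ (later rs x≮end)

  RecordsFrom : Fin n → List (Fin n) → Set
  RecordsFrom r rs =
    Sorted (r ∷ rs) × All (IsRecord w) (r ∷ rs) × (∀ t → IsRecord w t → r ≤ t → t ∈ r ∷ rs)

  recordsFrom-tail : ∀ {r r′ rs} → RecordsFrom r (r′ ∷ rs) → RecordsFrom r′ rs
  recordsFrom-tail {r} {r′} {rs} (r<rs ∷ sorted , _ ∷ records , complete) =
    sorted , records , complete′
    where
    complete′ : ∀ t → IsRecord w t → r′ ≤ t → t ∈ r′ ∷ rs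
    complete′ t isRec r′≤t with complete t isRec (ℕP.<⇒≤ (ℕP.<-≤-trans (All.head r<rs) r′≤t))
    ... | here refl = contradiction r′≤t (ℕP.<⇒≱ (All.head r<rs))
    ... | there t∈ = t∈

  recordsFrom-noRecordAfter : ∀ {r rs} → RecordsFrom r rs → NoRecordAfter r (blockEnd rs)
  recordsFrom-noRecordAfter (r<rs ∷ sorted , _ , complete) t isRec r<t t<end
    with complete t isRec (ℕP.<⇒≤ r<t)
  ... | here refl = ℕP.<-irrefl refl r<t
  ... | there t∈rs = ℕP.<⇒≱ t<end (blockEnd-≤ sorted t∈rs)

  -- The ordering from a record list is sorted for Precedes: each block is,
  -- and every element of a later block precedes every element of the
  -- current block, the next start being the separating record.
  ordering-precedes : ∀ {r rs} → RecordsFrom r rs → AllPairs Precedes (ordering (r ∷ rs))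
  ordering-precedes {r} {rs} from = subst (AllPairs Precedes) (sym (ordering-∷ r rs))
    (AllPairsP.++⁺ (later rs from)
      (interval-precedes r (blockEnd rs) (recordsFrom-noRecordAfter from)) (crossing rs from))
    where
    later : ∀ rs → RecordsFrom r rs → AllPairs Precedes (ordering rs)
    later [] _ = []
    later (r′ ∷ rs′) from = ordering-precedes (recordsFrom-tail from)
    crossing : ∀ rs → RecordsFrom r rs →
      All (λ x → All (Precedes x) (interval r (blockEnd rs))) (ordering rs)
    crossing [] _ = []
    crossing (r′ ∷ rs′) (_ ∷ sorted , _ ∷ r′-record ∷ _ , _) =
      All.tabulate λ x∈ → All.tabulate λ y∈ → separated x∈ y∈
      where
      separated : ∀ {x y} → x ∈ ordering (r′ ∷ rs′) → y ∈ interval r (toℕ r′) → Precedes x y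
      separated x∈ y∈ =
        inj₂ (ℕP.<-≤-trans y<r′ r′≤x , r′ , r′-record , y<r′ , r′≤x)
        where
        y<r′ = proj₂ (∈-interval⁻ y∈)
        r′≤x = ordering-bound sorted x∈

  RecordList : List (Fin n) → Set
  RecordList rs = Sorted rs × All (IsRecord w) rs × (∀ t → IsRecord w t → t ∈ rs)

  records-recordList : RecordList (records w)
  records-recordList =
    AllPairsP.filter⁺ (isRecord? w) allFin-sorted ,
    AllP.all-filter (isRecord? w) (allFin n) ,
    λ t isRec → ∈-filter⁺ (isRecord? w) (∈-allFin t) isRec

  recordList-precedes : ∀ {rs} → RecordList rs → AllPairs Precedes (ordering rs)
  recordList-precedes {[]} _ = []
  recordList-precedes {r ∷ rs} (sorted , records , complete) =
    ordering-precedes (sorted , records , λ t isRec _ → complete t isRec)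

  -- Every position v lies after its dominating record, hence after the
  -- first record, so it appears in the ordering.
  recordList-complete : ∀ {rs} → RecordList rs → ∀ v → v ∈ ordering rs
  recordList-complete {rs} (sorted , _ , complete) v with dominatingRecord v
  ... | m , isRec , m≤v , _ = covered rs sorted (complete m isRec)
    where
    covered : ∀ rs → Sorted rs → m ∈ rs → v ∈ ordering rs
    covered [] _ ()
    covered (r ∷ rs) sorted m∈ = ordering-complete {rs = rs} (ℕP.≤-trans (blockEnd-≤ sorted m∈) m≤v)

lemma7p1 : (n : ℕ) (w : Permutation′ n) →
    Avoids w p3412 → Avoids w p4231 →
    IsPEO (InvEdge w) (recordOrdering w)
lemma7p1 n w avoids3412 avoids4231 =
  perfectElimination (precedes⇒≢ w)
    (recordList-precedes w (records-recordList w))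
    (recordList-complete w (records-recordList w))
    (earlierNeighbours-adjacent w avoids3412 avoids4231)
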